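{- Let $v$ be a positive integer and $e$ an integer with $2\le e\le\binom v2$, and let $e'=\binom v2-e$. Then $C(v,e)\le U(e)$ and $S(v,e)\le U(e')+(v-1)(4e-v(v-1))$, where $U(x)=x(\sqrt{8x+1}-1)$.
   Context: For $0\le e\le\binom v2$ write $e=\binom{k+1}2-j$ with integers $1\le j\le k$, and set $C(v,e)=j(k-1)^2+(k-j)k^2+(k-j)^2$ (the sum of squared degrees of the quasi-complete graph: a complete graph on $k$ vertices, one further vertex adjacent to $k-j$ of them, and isolated vertices). $S(v,e)$ is the sum of squared degrees of the quasi-star graph, the complement of the quasi-complete graph with $v$ vertices and $\binom v2-e$ edges; equivalently $S(v,e)=C(v,\binom v2-e)+(v-1)(4e-v(v-1))$. -}

module Defs where

open import Data.Nat as ℕ using (ℕ; _∸_)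
open import Data.Integer as ℤ using (ℤ; +_; _-_; _≤_)
open import Data.Sum using (_⊎_)

-- Sum of squared degrees of the quasi-complete graph attached to the
-- decomposition e = binom(k+1,2) - j (1 ≤ j ≤ k):
--   C = j (k-1)^2 + (k-j) k^2 + (k-j)^2.
Cq : ℕ → ℕ → ℕ
Cq k j = j ℕ.* ((k ∸ 1) ℕ.* (k ∸ 1))
       ℕ.+ (k ∸ j) ℕ.* (k ℕ.* k)
       ℕ.+ (k ∸ j) ℕ.* (k ∸ j)

Dq : ℕ → ℕ → ℤ
Dq v e = (+ v - + 1) ℤ.* (+ (4 ℕ.* e) - (+ v ℤ.* (+ v - + 1)))

-- S(v,e) = C(v, binom v 2 - e) + (v-1)(4e - v(v-1)),
-- where (k , j) is the decomposition of binom v 2 - e.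
Sq : ℕ → ℕ → ℕ → ℕ → ℤ
Sq k j v e = + Cq k j ℤ.+ Dq v e

-- The real inequality  a ≤ U(x) + b,  where U(x) = x (√(8x+1) - 1),
-- written out exactly over the integers: with s = √(8x+1) ≥ 0 it reads
-- a - b + x ≤ x s, and since x s ≥ 0 this holds iff either the left side is
-- ≤ 0, or its square is ≤ x² (8x+1).
LeUPlus : ℤ → ℕ → ℤ → Set
LeUPlus a x b =
  (a - b ℤ.+ + x ≤ + 0)
  ⊎ ((a - b ℤ.+ + x) ℤ.* (a - b ℤ.+ + x)
       ≤ + (x ℕ.* x ℕ.* (8 ℕ.* x ℕ.+ 1)))

{-# OPTIONS --safe #-}
module Submission where

open import Defs
open import Data.Nat using (ℕ; zero; suc; _+_; _*_; _∸_; _≤_; s≤s; z≤n)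
open import Data.Nat.Properties
  using (*-distribˡ-+; +-cancelʳ-≡; *-cancelˡ-≤; m+n∸m≡n; m≤m+n; ≤-reflexive; ≤-trans;
         m≤n⇒∃[o]m+o≡n)
open import Data.Nat.Combinatorics using (_C_; nCk+nC[k+1]≡[n+1]C[k+1]; nC1≡n)
open import Data.Nat.Tactic.RingSolver using (solve-∀)
open import Data.Integer using (+_)
import Data.Integer as ℤ
open import Data.Integer.Properties using (pos-*; +-identityʳ)
import Data.Integer.Tactic.RingSolver as ℤ-Solver
open import Data.Sum using (inj₂)
open import Data.Product using (_×_; _,_)
open import Relation.Binary.PropositionalEquality
  using (_≡_; refl; sym; cong; subst; subst₂; module ≡-Reasoning)

-- Write j = 1 + a and k = 1 + a + m. Then 2x = (a + m)² + a + 3m and C are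
-- polynomials in a and m, and C ≤ x (√(8x+1) - 1) is equivalent to the
-- polynomial inequality (2C + 2x)² ≤ (2x)² (8x + 1). For m = 0 (the complete
-- graph K_{a+1}, where 8x + 1 = (2a + 1)²) it is an equality; for m = 1 + n the
-- difference of the two sides is 4 R(a, n) for an explicit polynomial R with
-- nonnegative coefficients. The bound on S is the bound on C at e′, shifted by
-- D on both sides.

2*[1+n]C2≡[1+n]*n : ∀ n → 2 * (suc n C 2) ≡ suc n * n
2*[1+n]C2≡[1+n]*n zero = refl
2*[1+n]C2≡[1+n]*n (suc n) = begin
  2 * (suc (suc n) C 2)         ≡⟨ cong (2 *_) (sym (nCk+nC[k+1]≡[n+1]C[k+1] (suc n) 1)) ⟩
  2 * (suc n C 1 + suc n C 2)   ≡⟨ cong (λ t → 2 * (t + suc n C 2)) (nC1≡n (suc n)) ⟩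
  2 * (suc n + suc n C 2)       ≡⟨ *-distribˡ-+ 2 (suc n) (suc n C 2) ⟩
  2 * suc n + 2 * (suc n C 2)   ≡⟨ cong (_+_ (2 * suc n)) (2*[1+n]C2≡[1+n]*n n) ⟩
  2 * suc n + suc n * n         ≡⟨ step n ⟩
  suc (suc n) * suc n           ∎
  where
  open ≡-Reasoning
  step : ∀ n → 2 * suc n + suc n * n ≡ suc (suc n) * suc n
  step = solve-∀

_≤U_ : ℕ → ℕ → Set
c ≤U x = (c + x) * (c + x) ≤ x * x * (8 * x + 1)

≤U-fromDouble : ∀ c x →
  (2 * c + 2 * x) * (2 * c + 2 * x) ≤ 2 * x * (2 * x) * (4 * (2 * x) + 1) → c ≤U x
≤U-fromDouble c x h = *-cancelˡ-≤ 4 (subst₂ _≤_ (sym (lhs c x)) (sym (rhs x)) h)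
  where
  lhs : ∀ c x → 4 * ((c + x) * (c + x)) ≡ (2 * c + 2 * x) * (2 * c + 2 * x)
  lhs = solve-∀
  rhs : ∀ x → 4 * (x * x * (8 * x + 1)) ≡ 2 * x * (2 * x) * (4 * (2 * x) + 1)
  rhs = solve-∀

twiceEdges : ℕ → ℕ → ℕ
twiceEdges a m = (a + m) * (a + m) + a + 3 * m

squareSum : ℕ → ℕ → ℕ
squareSum a m = (1 + a) * ((a + m) * (a + m)) + m * ((1 + a + m) * (1 + a + m)) + m * m

squareSum-bound : ∀ a m →
  let X = twiceEdges a m in
  (2 * squareSum a m + X) * (2 * squareSum a m + X) ≤ X * X * (4 * X + 1)
squareSum-bound a zero = ≤-reflexive (complete a)
  where
  -- The ring solver does not unfold definitions, so twiceEdges and squareSum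
  -- are spelled out here and in gap below.
  complete : ∀ a →
    let m = 0
        X = (a + m) * (a + m) + a + 3 * m
        C = (1 + a) * ((a + m) * (a + m)) + m * ((1 + a + m) * (1 + a + m)) + m * m
    in (2 * C + X) * (2 * C + X) ≡ X * X * (4 * X + 1)
  complete = solve-∀
squareSum-bound a (suc n) = ≤-trans (m≤m+n _ _) (≤-reflexive (gap a n))
  where
  gap : ∀ a n →
    let m = 1 + n
        X = (a + m) * (a + m) + a + 3 * m
        C = (1 + a) * ((a + m) * (a + m)) + m * ((1 + a + m) * (1 + a + m)) + m * m
        a² = a * a
        n² = n * n
        R = 4 + 18 * n + 26 * n² + 14 * n² * n + 2 * n² * n²
          + a * (14 + 45 * n + 49 * n² + 20 * n² * n + 2 * n² * n²)
          + a² * (16 + 39 * n + 29 * n² + 6 * n² * n)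
          + a² * a * (8 + 14 * n + 6 * n²)
          + a² * a² * (2 + 2 * n)
    in (2 * C + X) * (2 * C + X) + 4 * R ≡ X * X * (4 * X + 1)
  gap = solve-∀

Cq≡squareSum : ∀ a m → Cq (suc a + m) (suc a) ≡ squareSum a m
Cq≡squareSum a m =
  cong (λ t → (1 + a) * ((a + m) * (a + m)) + t * ((1 + a + m) * (1 + a + m)) + t * t)
       (m+n∸m≡n a m)

2*x≡twiceEdges : ∀ a m x → x + suc a ≡ suc (suc a + m) C 2 → 2 * x ≡ twiceEdges a m
2*x≡twiceEdges a m x h = +-cancelʳ-≡ (2 * suc a) (2 * x) (twiceEdges a m) (begin
  2 * x + 2 * suc a            ≡⟨ sym (*-distribˡ-+ 2 x (suc a)) ⟩
  2 * (x + suc a)              ≡⟨ cong (2 *_) h ⟩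
  2 * (suc (suc a + m) C 2)    ≡⟨ 2*[1+n]C2≡[1+n]*n (suc a + m) ⟩
  suc (suc a + m) * (suc a + m) ≡⟨ expand a m ⟩
  twiceEdges a m + 2 * suc a   ∎)
  where
  open ≡-Reasoning
  expand : ∀ a m → (2 + a + m) * (1 + a + m) ≡ (a + m) * (a + m) + a + 3 * m + 2 * (1 + a)
  expand = solve-∀

Cq-≤U : ∀ {k j x} → 1 ≤ j → j ≤ k → x + j ≡ suc k C 2 → Cq k j ≤U x
Cq-≤U {j = suc a} {x} (s≤s z≤n) j≤k h with m≤n⇒∃[o]m+o≡n j≤k
... | m , refl =
  subst (_≤U x) (sym (Cq≡squareSum a m))
    (≤U-fromDouble (squareSum a m) x
      (subst (λ X → (2 * squareSum a m + X) * (2 * squareSum a m + X) ≤ X * X * (4 * X + 1))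
             (sym (2*x≡twiceEdges a m x h))
             (squareSum-bound a m)))

LeUPlus-fromℕ : ∀ a b {c x} → a ℤ.- b ≡ + c → c ≤U x → LeUPlus a x b
LeUPlus-fromℕ a b {c} {x} a-b≡c h =
  inj₂ (subst (λ i → i ℤ.* i ℤ.≤ + (x * x * (8 * x + 1))) (sym (cong (ℤ._+ + x) a-b≡c))
    (subst (ℤ._≤ + (x * x * (8 * x + 1))) (pos-* (c + x) (c + x)) (ℤ.+≤+ h)))

lemma4 : (v e : ℕ) → 1 ≤ v → 2 ≤ e → e ≤ v C 2 →
    ((k j : ℕ) → 1 ≤ j → j ≤ k → e + j ≡ suc k C 2 →
       LeUPlus (+ Cq k j) e (+ 0))
    × ((k j : ℕ) → 1 ≤ j → j ≤ k → (v C 2 ∸ e) + j ≡ suc k C 2 →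
       LeUPlus (Sq k j v e) (v C 2 ∸ e) (Dq v e))
lemma4 v e _ _ _ =
  (λ k j 1≤j j≤k h → LeUPlus-fromℕ (+ Cq k j) (+ 0) (+-identityʳ (+ Cq k j)) (Cq-≤U 1≤j j≤k h)) ,
  (λ k j 1≤j j≤k h → LeUPlus-fromℕ (Sq k j v e) (Dq v e) (i+d-d≡i (+ Cq k j) (Dq v e)) (Cq-≤U 1≤j j≤k h))
  where
  i+d-d≡i : ∀ i d → i ℤ.+ d ℤ.- d ≡ i
  i+d-d≡i = ℤ-Solver.solve-∀
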